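{- Let $q$ be a prime power, $E=\mathbb{F}_q^n$, let $\mathcal{M}_1=(\mathcal{L}(E),\rho_1)$, $\mathcal{M}_2=(\mathcal{L}(E),\rho_2)$ be two distinct $q$-matroids, let $\lambda\in\mathbb{Q}$ with $0<\lambda<1$, and let $\mathcal{M}=\lambda\mathcal{M}_1+(1-\lambda)\mathcal{M}_2$. Let $\mu=\mathrm{denom}(\lambda)$ and assume that there exists a one-dimensional subspace $x\le E$ which is strong independent in $\mathcal{M}$. Then $\mu$ is the principal denominator of $\mathcal{M}$.
   Context: A $q$-matroid is $(\mathcal{L}(E),\rho)$ with $\rho$ integer-valued, $0\le\rho(A)\le\dim A$, monotone and submodular. $\lambda\mathcal{M}_1+(1-\lambda)\mathcal{M}_2$ has rank function $\rho=\lambda\rho_1+(1-\lambda)\rho_2$. $\mathrm{denom}(\lambda)$ is $b$ where $\lambda=a/b$ in lowest terms. A denominator of $\mathcal{M}$ is $\nu\in\mathbb{Q}_{>0}$ with $\nu\rho(X)\in\mathbb{Z}_{\ge0}$ for all $X$; the principal denominator is the smallest one. For a denominator $\nu$, a space $I$ is $\nu$-independent if $\rho(J)\ge\dim(J)/\nu$ for all $J\le I$, and strong independent if it is $\nu$-independent and $\rho(I)=\dim I$. -}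

module Defs where

open import Level using (Level; _⊔_; suc)
open import Algebra.Bundles using (CommutativeRing)
import Algebra.Definitions.RawMonoid as RawMonoidDefs
open import Data.Nat as ℕ using (ℕ)
open import Data.Nat.Primality using (Prime)
open import Data.Fin using (Fin)
open import Data.Vec.Functional using (Vector; _++_)
open import Data.Product using (Σ; ∃; ∃-syntax; _×_; _,_)
open import Data.Integer using (+_)
open import Data.Rational as ℚ using (ℚ; _/_; _≤_; _<_; 0ℚ; 1ℚ)
open import Function.Bundles using (Inverse)
open import Relation.Binary.PropositionalEquality using (_≡_) renaming (setoid to ≡-setoid)
open import Relation.Nullary using (¬_)

record FiniteField (c ℓ : Level) (q : ℕ) : Set (suc (c ⊔ ℓ)) where
  field
    commRing : CommutativeRing c ℓ
  open CommutativeRing commRing public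
  field
    0≉1      : ¬ (0# ≈ 1#)
    inverse  : ∀ x → ¬ (x ≈ 0#) → ∃[ y ] (x * y ≈ 1#)
    enumerate : Inverse (≡-setoid (Fin q)) setoid

IsPrimePower : ℕ → Set
IsPrimePower q = ∃[ p ] ∃[ k ] (Prime p × q ≡ p ℕ.^ ℕ.suc k)

module Lattice {c ℓ : Level} {q : ℕ} (F : FiniteField c ℓ q) (n : ℕ) where
  open FiniteField F using (Carrier; _≈_; 0#; _*_; +-rawMonoid)
  open RawMonoidDefs +-rawMonoid using (sum)

  V : Set c
  V = Vector Carrier n

  _≈ᵥ_ : V → V → Set ℓ
  u ≈ᵥ v = ∀ i → u i ≈ v i

  0ᵥ : V
  0ᵥ _ = 0#

  lincomb : ∀ {m} → Vector Carrier m → Vector V m → V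
  lincomb a g i = sum (λ j → a j * g j i)

  -- A subspace of E, presented by a finite list of spanning vectors.
  -- Two presentations denote the same subspace iff their spans agree (_≐_);
  -- every subspace of F^n has such a presentation.
  Subspace : Set c
  Subspace = Σ ℕ (λ m → Vector V m)

  _∈_ : V → Subspace → Set (c ⊔ ℓ)
  v ∈ (m , g) = ∃[ a ] (v ≈ᵥ lincomb {m} a g)

  _≼_ : Subspace → Subspace → Set (c ⊔ ℓ)
  A ≼ B = ∀ v → v ∈ A → v ∈ B

  _≐_ : Subspace → Subspace → Set (c ⊔ ℓ)
  A ≐ B = A ≼ B × B ≼ A

  _⊕_ : Subspace → Subspace → Subspace
  (m , g) ⊕ (k , h) = (m ℕ.+ k , g ++ h)

  IsMeet : Subspace → Subspace → Subspace → Set (c ⊔ ℓ)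
  IsMeet A B C = ∀ v → (v ∈ C → v ∈ A × v ∈ B) × (v ∈ A × v ∈ B → v ∈ C)

  LinIndep : ∀ {d} → Vector V d → Set (c ⊔ ℓ)
  LinIndep {d} g = ∀ a → lincomb a g ≈ᵥ 0ᵥ → ∀ j → a j ≈ 0#

  HasDim : Subspace → ℕ → Set (c ⊔ ℓ)
  HasDim A d = ∃[ b ] (LinIndep {d} b × (d , b) ≐ A)

  record QMatroid : Set (suc (c ⊔ ℓ)) where
    field
      ρ          : Subspace → ℕ
      -- ρ is a function on subspaces (independent of the presentation)
      ρ-resp     : ∀ A B → A ≐ B → ρ A ≡ ρ B
      -- 0 ≤ ρ(A) ≤ dim A  (0 ≤ ρ is automatic in ℕ)
      ρ-bounded  : ∀ A d → HasDim A d → ρ A ℕ.≤ d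
      ρ-monotone : ∀ A B → A ≼ B → ρ A ℕ.≤ ρ B
      ρ-submod   : ∀ A B C → IsMeet A B C → ρ (A ⊕ B) ℕ.+ ρ C ℕ.≤ ρ A ℕ.+ ρ B

  open QMatroid public

  ℕ→ℚ : ℕ → ℚ
  ℕ→ℚ k = + k / 1

  combRank : ℚ → QMatroid → QMatroid → Subspace → ℚ
  combRank λ′ M₁ M₂ X = λ′ ℚ.* ℕ→ℚ (ρ M₁ X) ℚ.+ (1ℚ ℚ.- λ′) ℚ.* ℕ→ℚ (ρ M₂ X)

  IsDenominator : (Subspace → ℚ) → ℚ → Set c
  IsDenominator r ν = 0ℚ < ν × (∀ X → ∃[ k ] (ν ℚ.* r X ≡ ℕ→ℚ k))

  IsPrincipalDenominator : (Subspace → ℚ) → ℚ → Set c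
  IsPrincipalDenominator r μ =
    IsDenominator r μ × (∀ ν → IsDenominator r ν → μ ≤ ν)

  IsνIndependent : (Subspace → ℚ) → ℚ → Subspace → Set (c ⊔ ℓ)
  IsνIndependent r ν I =
    ∀ J → J ≼ I → ∀ d → HasDim J d → ℕ→ℚ d ≤ ν ℚ.* r J

  IsStrongIndependent : (Subspace → ℚ) → ℚ → Subspace → Set (c ⊔ ℓ)
  IsStrongIndependent r ν I =
    IsνIndependent r ν I × (∀ d → HasDim I d → r I ≡ ℕ→ℚ d)

-- Write λ = a/μ in lowest terms. Then μρ = aρ₁ + (μ − a)ρ₂ is integral, so μ is a denominator.
-- Conversely, a denominator ν equals the integer νρ(x), since ρ(x) = dim x = 1. Adding one vector
-- to a space raises each ρᵢ by 0 or 1, so where ρ₁ and ρ₂ first disagree along a chain of spaces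
-- there is a Y with ρ₁(Y) − ρ₂(Y) = ±1. Then νρ(Y) differs from an integer by ±νλ, so νa/μ is an
-- integer, and as a and μ are coprime, μ ∣ ν.
module Submission where

open import Defs
open import Level using (Level)
open import Data.Nat using (ℕ)
open import Data.Product using (_×_; ∃-syntax; _,_)
open import Data.Integer using (+_)
open import Data.Rational using (ℚ; _<_; 0ℚ; 1ℚ; _/_; ↧ₙ_)
open import Relation.Binary.PropositionalEquality using (_≡_)
open import Relation.Nullary using (¬_)

module Arithmetic where
  open import Data.Nat as ℕ using (suc; _∸_)
  import Data.Nat.Properties as ℕ
  open import Data.Nat.Coprimality as Coprime using (Coprime; coprime-divisor)
  open import Data.Nat.Divisibility using (_∣_; divides; ∣m+n∣m⇒∣n; n∣m*n)
  import Data.Integer as ℤ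
  import Data.Integer.Properties as ℤ
  open import Data.Rational as ℚ using (mkℚ; _+_; _*_; _-_; _≤_; ↥_; ↧_; toℚᵘ)
  import Data.Rational.Properties as ℚ
  open import Data.Rational.Solver using (module +-*-Solver)
  open import Data.Rational.Unnormalised as ℚᵘ using (mkℚᵘ; *≡*; *≤*) renaming (_≃_ to _≃ᵘ_)
  import Data.Rational.Unnormalised.Properties as ℚᵘ
  open import Data.Sum using (_⊎_; inj₁; inj₂)
  open import Data.Empty using (⊥-elim)
  open import Relation.Binary.PropositionalEquality
    using (_≢_; refl; sym; trans; cong; cong₂; subst; subst₂; module ≡-Reasoning)

  t≤x≤1+t⇒x≡t∨x≡1+t : ∀ {t x} → t ℕ.≤ x → x ℕ.≤ suc t → x ≡ t ⊎ x ≡ suc t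
  t≤x≤1+t⇒x≡t∨x≡1+t t≤x x≤1+t with ℕ.m≤n⇒m<n∨m≡n t≤x
  ... | inj₁ t<x = inj₂ (ℕ.≤-antisym x≤1+t t<x)
  ... | inj₂ t≡x = inj₁ (sym t≡x)

  ≢-within-step⇒adjacent : ∀ {t x y} → t ℕ.≤ x → x ℕ.≤ suc t → t ℕ.≤ y → y ℕ.≤ suc t → x ≢ y →
                           x ≡ suc y ⊎ y ≡ suc x
  ≢-within-step⇒adjacent t≤x x≤1+t t≤y y≤1+t x≢y
    with t≤x≤1+t⇒x≡t∨x≡1+t t≤x x≤1+t | t≤x≤1+t⇒x≡t∨x≡1+t t≤y y≤1+t
  ... | inj₁ refl | inj₁ refl = ⊥-elim (x≢y refl)
  ... | inj₁ refl | inj₂ refl = inj₂ refl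
  ... | inj₂ refl | inj₁ refl = inj₁ refl
  ... | inj₂ refl | inj₂ refl = ⊥-elim (x≢y refl)

  -- Definitionally equal to Lattice.ℕ→ℚ.
  fromℕ : ℕ → ℚ
  fromℕ k = + k / 1

  toℚᵘ-fromℕ : ∀ k → toℚᵘ (fromℕ k) ≃ᵘ mkℚᵘ (+ k) 0
  toℚᵘ-fromℕ k = ℚ.toℚᵘ-fromℚᵘ (mkℚᵘ (+ k) 0)

  fromℕ-+ : ∀ m n → fromℕ (m ℕ.+ n) ≡ fromℕ m + fromℕ n
  fromℕ-+ m n = ℚ.toℚᵘ-injective (begin
    toℚᵘ (fromℕ (m ℕ.+ n))                ≈⟨ toℚᵘ-fromℕ (m ℕ.+ n) ⟩
    mkℚᵘ (+ (m ℕ.+ n)) 0                  ≈⟨ *≡* (cong (ℤ._* + 1) +[m+n]≡m*1+n*1) ⟩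
    mkℚᵘ (+ m) 0 ℚᵘ.+ mkℚᵘ (+ n) 0        ≈⟨ ℚᵘ.+-cong (toℚᵘ-fromℕ m) (toℚᵘ-fromℕ n) ⟨
    toℚᵘ (fromℕ m) ℚᵘ.+ toℚᵘ (fromℕ n)    ≈⟨ ℚ.toℚᵘ-homo-+ (fromℕ m) (fromℕ n) ⟨
    toℚᵘ (fromℕ m + fromℕ n)              ∎)
    where
    open ℚᵘ.≃-Reasoning
    +[m+n]≡m*1+n*1 : + (m ℕ.+ n) ≡ + m ℤ.* + 1 ℤ.+ + n ℤ.* + 1
    +[m+n]≡m*1+n*1 = trans (ℤ.pos-+ m n) (sym (cong₂ ℤ._+_ (ℤ.*-identityʳ (+ m)) (ℤ.*-identityʳ (+ n))))

  fromℕ-* : ∀ m n → fromℕ (m ℕ.* n) ≡ fromℕ m * fromℕ n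
  fromℕ-* m n = ℚ.toℚᵘ-injective (begin
    toℚᵘ (fromℕ (m ℕ.* n))                ≈⟨ toℚᵘ-fromℕ (m ℕ.* n) ⟩
    mkℚᵘ (+ (m ℕ.* n)) 0                  ≈⟨ *≡* (cong (ℤ._* + 1) (ℤ.pos-* m n)) ⟩
    mkℚᵘ (+ m) 0 ℚᵘ.* mkℚᵘ (+ n) 0        ≈⟨ ℚᵘ.*-cong (toℚᵘ-fromℕ m) (toℚᵘ-fromℕ n) ⟨
    toℚᵘ (fromℕ m) ℚᵘ.* toℚᵘ (fromℕ n)    ≈⟨ ℚ.toℚᵘ-homo-* (fromℕ m) (fromℕ n) ⟨
    toℚᵘ (fromℕ m * fromℕ n)              ∎)
    where open ℚᵘ.≃-Reasoning

  fromℕ-∸ : ∀ {m n} → n ℕ.≤ m → fromℕ (m ∸ n) ≡ fromℕ m - fromℕ n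
  fromℕ-∸ {m} {n} n≤m = begin
    fromℕ (m ∸ n)                         ≡⟨ solve 2 (λ x y → x := (x :+ y) :- y)
                                                     refl (fromℕ (m ∸ n)) (fromℕ n) ⟩
    (fromℕ (m ∸ n) + fromℕ n) - fromℕ n   ≡⟨ cong (_- fromℕ n) (fromℕ-+ (m ∸ n) n) ⟨
    fromℕ (m ∸ n ℕ.+ n) - fromℕ n         ≡⟨ cong (λ k → fromℕ k - fromℕ n) (ℕ.m∸n+n≡m n≤m) ⟩
    fromℕ m - fromℕ n                     ∎
    where
    open ≡-Reasoning
    open +-*-Solver

  fromℕ-injective : ∀ {m n} → fromℕ m ≡ fromℕ n → m ≡ n
  fromℕ-injective {m} {n} eq
    with ℚᵘ.≃-trans (ℚᵘ.≃-sym (toℚᵘ-fromℕ m)) (ℚᵘ.≃-trans (ℚ.toℚᵘ-cong eq) (toℚᵘ-fromℕ n))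
  ... | *≡* m*1≡n*1 = ℤ.+-injective (ℤ.*-cancelʳ-≡ (+ m) (+ n) (+ 1) m*1≡n*1)

  fromℕ-mono-≤ : ∀ {m n} → m ℕ.≤ n → fromℕ m ≤ fromℕ n
  fromℕ-mono-≤ {m} {n} m≤n = ℚ.toℚᵘ-cancel-≤ (begin
    toℚᵘ (fromℕ m)  ≃⟨ toℚᵘ-fromℕ m ⟩
    mkℚᵘ (+ m) 0    ≤⟨ *≤* (ℤ.*-monoʳ-≤-nonNeg (+ 1) (ℤ.+≤+ m≤n)) ⟩
    mkℚᵘ (+ n) 0    ≃⟨ toℚᵘ-fromℕ n ⟨
    toℚᵘ (fromℕ n)  ∎)
    where open ℚᵘ.≤-Reasoning

  fromℕ-pos : ∀ n .{{_ : ℕ.NonZero n}} → 0ℚ < fromℕ n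
  fromℕ-pos n = ℚ.positive⁻¹ _ {{ℚ.normalize-pos n 1}}

  ↥-nonNeg : ∀ {p} → 0ℚ ≤ p → ↥ p ≡ + ℤ.∣ ↥ p ∣
  ↥-nonNeg 0≤p = sym (ℤ.0≤i⇒+∣i∣≡i (ℤ.≤-trans (ℚ.drop-*≤* 0≤p) (ℤ.≤-reflexive (ℤ.*-identityʳ _))))

  ≤1⇒↥≤↧ : ∀ {p} → p ≤ 1ℚ → ↥ p ℤ.≤ ↧ p
  ≤1⇒↥≤↧ p≤1 = subst₂ ℤ._≤_ (ℤ.*-identityʳ _) (ℤ.*-identityˡ _) (ℚ.drop-*≤* p≤1)

  ↧ₙ*p≡↥p : ∀ p → fromℕ (↧ₙ p) * p ≡ ↥ p / 1
  ↧ₙ*p≡↥p p@(mkℚ n d _) = ℚ.toℚᵘ-injective (begin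
    toℚᵘ (fromℕ (suc d) * p)              ≈⟨ ℚ.toℚᵘ-homo-* (fromℕ (suc d)) p ⟩
    toℚᵘ (fromℕ (suc d)) ℚᵘ.* mkℚᵘ n d    ≈⟨ ℚᵘ.*-congʳ (toℚᵘ-fromℕ (suc d)) ⟩
    mkℚᵘ (+ suc d) 0 ℚᵘ.* mkℚᵘ n d        ≈⟨ *≡* [d*n]*1≡n*[d+0] ⟩
    mkℚᵘ n 0                              ≈⟨ ℚ.toℚᵘ-fromℚᵘ (mkℚᵘ n 0) ⟨
    toℚᵘ (n / 1)                          ∎)
    where
    open ℚᵘ.≃-Reasoning
    [d*n]*1≡n*[d+0] : (+ suc d ℤ.* n) ℤ.* + 1 ≡ n ℤ.* + suc (d ℕ.+ 0)
    [d*n]*1≡n*[d+0] = trans (ℤ.*-identityʳ _)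
      (trans (ℤ.*-comm (+ suc d) n) (cong (λ e → n ℤ.* + suc e) (sym (ℕ.+-identityʳ d))))

  ↧ₙ*combination≡ : ∀ p {a} → ↥ p ≡ + a → p ≤ 1ℚ → ∀ r₁ r₂ →
    fromℕ (↧ₙ p) * (p * fromℕ r₁ + (1ℚ - p) * fromℕ r₂) ≡ fromℕ (a ℕ.* r₁ ℕ.+ (↧ₙ p ∸ a) ℕ.* r₂)
  ↧ₙ*combination≡ p {a} ↥p≡a p≤1 r₁ r₂ = begin
    μ * (p * R₁ + (1ℚ - p) * R₂)                  ≡⟨ solve 4 (λ μ p R₁ R₂ →
                                                       μ :* (p :* R₁ :+ (con 1ℚ :- p) :* R₂)
                                                       := (μ :* p) :* R₁ :+ (μ :- μ :* p) :* R₂)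
                                                       refl μ p R₁ R₂ ⟩
    (μ * p) * R₁ + (μ - μ * p) * R₂               ≡⟨ cong (λ x → x * R₁ + (μ - x) * R₂) μp≡a ⟩
    fromℕ a * R₁ + (μ - fromℕ a) * R₂             ≡⟨ cong (λ x → fromℕ a * R₁ + x * R₂) (fromℕ-∸ a≤μ) ⟨
    fromℕ a * R₁ + fromℕ (↧ₙ p ∸ a) * R₂          ≡⟨ cong₂ _+_ (fromℕ-* a r₁) (fromℕ-* (↧ₙ p ∸ a) r₂) ⟨
    fromℕ (a ℕ.* r₁) + fromℕ ((↧ₙ p ∸ a) ℕ.* r₂)  ≡⟨ fromℕ-+ (a ℕ.* r₁) ((↧ₙ p ∸ a) ℕ.* r₂) ⟨
    fromℕ (a ℕ.* r₁ ℕ.+ (↧ₙ p ∸ a) ℕ.* r₂)        ∎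
    where
    open ≡-Reasoning
    open +-*-Solver
    μ R₁ R₂ : ℚ
    μ = fromℕ (↧ₙ p)
    R₁ = fromℕ r₁
    R₂ = fromℕ r₂
    μp≡a : μ * p ≡ fromℕ a
    μp≡a = trans (↧ₙ*p≡↥p p) (cong (_/ 1) ↥p≡a)
    a≤μ : a ℕ.≤ ↧ₙ p
    a≤μ = ℤ.drop‿+≤+ (subst (ℤ._≤ ↧ p) ↥p≡a (≤1⇒↥≤↧ p≤1))

  p*[1+s]+[1-p]*s≡p+s : ∀ p s → p * fromℕ (suc s) + (1ℚ - p) * fromℕ s ≡ p + fromℕ s
  p*[1+s]+[1-p]*s≡p+s p s = begin
    p * fromℕ (suc s) + (1ℚ - p) * fromℕ s   ≡⟨ cong (λ x → p * x + (1ℚ - p) * fromℕ s) (fromℕ-+ 1 s) ⟩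
    p * (1ℚ + fromℕ s) + (1ℚ - p) * fromℕ s  ≡⟨ solve 2 (λ p s → p :* (con 1ℚ :+ s) :+ (con 1ℚ :- p) :* s
                                                              := p :+ s) refl p (fromℕ s) ⟩
    p + fromℕ s                              ∎
    where
    open ≡-Reasoning
    open +-*-Solver

  p+[p*s+[1-p]*[1+s]]≡1+s : ∀ p s → p + (p * fromℕ s + (1ℚ - p) * fromℕ (suc s)) ≡ fromℕ (suc s)
  p+[p*s+[1-p]*[1+s]]≡1+s p s = begin
    p + (p * fromℕ s + (1ℚ - p) * fromℕ (suc s))   ≡⟨ cong (λ x → p + (p * fromℕ s + (1ℚ - p) * x))
                                                           (fromℕ-+ 1 s) ⟩
    p + (p * fromℕ s + (1ℚ - p) * (1ℚ + fromℕ s))  ≡⟨ solve 2 (λ p s →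
                                                           p :+ (p :* s :+ (con 1ℚ :- p) :* (con 1ℚ :+ s))
                                                           := con 1ℚ :+ s) refl p (fromℕ s) ⟩
    1ℚ + fromℕ s                                   ≡⟨ fromℕ-+ 1 s ⟨
    fromℕ (suc s)                                  ∎
    where
    open ≡-Reasoning
    open +-*-Solver

  -- That K·p is an integer is stated additively, so that all quantities stay in ℕ.
  ↧ₙ∣-if-integral : ∀ p {a} → ↥ p ≡ + a → ∀ K u w → fromℕ K * p + fromℕ u ≡ fromℕ w → ↧ₙ p ∣ K
  ↧ₙ∣-if-integral p@(mkℚ _ _ coprime) {a} ↥p≡a K u w eq =
    coprime-divisor μ⊥a (∣m+n∣m⇒∣n (divides w (fromℕ-injective cleared)) (n∣m*n u))
    where
    open ≡-Reasoning
    open +-*-Solver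
    μ = ↧ₙ p
    μ⊥a : Coprime μ a
    μ⊥a = Coprime.sym (subst (λ m → Coprime m μ) (cong ℤ.∣_∣ ↥p≡a) (Coprime.recompute coprime))
    cleared : fromℕ (u ℕ.* μ ℕ.+ a ℕ.* K) ≡ fromℕ (w ℕ.* μ)
    cleared = begin
      fromℕ (u ℕ.* μ ℕ.+ a ℕ.* K)                  ≡⟨ trans (fromℕ-+ (u ℕ.* μ) (a ℕ.* K))
                                                           (cong₂ _+_ (fromℕ-* u μ) (fromℕ-* a K)) ⟩
      fromℕ u * fromℕ μ + fromℕ a * fromℕ K        ≡⟨ cong (λ x → fromℕ u * fromℕ μ + x * fromℕ K)
                                                           (trans (↧ₙ*p≡↥p p) (cong (_/ 1) ↥p≡a)) ⟨
      fromℕ u * fromℕ μ + (fromℕ μ * p) * fromℕ K  ≡⟨ solve 4 (λ U M P k → U :* M :+ (M :* P) :* k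
                                                                         := (k :* P :+ U) :* M)
                                                           refl (fromℕ u) (fromℕ μ) p (fromℕ K) ⟩
      (fromℕ K * p + fromℕ u) * fromℕ μ            ≡⟨ cong (_* fromℕ μ) eq ⟩
      fromℕ w * fromℕ μ                            ≡⟨ fromℕ-* w μ ⟨
      fromℕ (w ℕ.* μ)                              ∎

open Arithmetic

module Span {c ℓ : Level} {q : ℕ} (F : FiniteField c ℓ q) (n : ℕ) where
  open FiniteField F hiding (zero)
  open Lattice F n
  open import Algebra.Properties.Semiring.Sum semiring using (sum; *-distribˡ-sum; sum-cong-≋)
  open import Data.Nat using (suc)
  open import Data.Fin using (zero; _≟_)
  open import Data.Vec.Functional using (Vector; _∷_; tail)
  open import Data.Product using (proj₁)
  open import Data.Empty using (⊥-elim)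
  import Function.Construct.Symmetry as Symmetry
  open import Function.Properties.Inverse using (Inverse⇒Injection)
  open import Relation.Binary.Definitions using (Decidable)
  open import Relation.Nullary using (yes; no)
  open import Relation.Nullary.Decidable using (via-injection)
  open import Relation.Binary.Reasoning.Setoid setoid

  _≈?_ : Decidable _≈_
  _≈?_ = via-injection (Inverse⇒Injection (Symmetry.inverse enumerate)) _≟_

  scale-inverse : ∀ {a b u w} → a * b ≈ 1# → w ≈ a * u → u ≈ b * w
  scale-inverse {a} {b} {u} {w} ab≈1 w≈au = begin
    u             ≈⟨ *-identityˡ u ⟨
    1# * u        ≈⟨ *-congʳ (trans (sym ab≈1) (*-comm a b)) ⟩
    (b * a) * u   ≈⟨ *-assoc b a u ⟩
    b * (a * u)   ≈⟨ *-congˡ w≈au ⟨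
    b * w         ∎

  ⟨_⟩ : V → Subspace
  ⟨ v ⟩ = 1 , λ _ → v

  𝟎 : Subspace
  𝟎 = 0 , λ ()

  ∈-resp-≈ᵥ : ∀ {u v} A → u ≈ᵥ v → v ∈ A → u ∈ A
  ∈-resp-≈ᵥ A u≈v (a , v≈ag) = a , λ i → trans (u≈v i) (v≈ag i)

  ∈-scale : ∀ {v} A b → v ∈ A → (λ i → b * v i) ∈ A
  ∈-scale {v} (m , g) b (a , v≈ag) = (λ j → b * a j) , λ i → begin
    b * v i                         ≈⟨ *-congˡ (v≈ag i) ⟩
    b * lincomb a g i               ≈⟨ *-distribˡ-sum b (λ j → a j * g j i) ⟩
    sum (λ j → b * (a j * g j i))   ≈⟨ sum-cong-≋ (λ j → sym (*-assoc b (a j) (g j i))) ⟩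
    sum (λ j → (b * a j) * g j i)   ∎

  ∈⟨⟩⇒multiple : ∀ {v w} → w ∈ ⟨ v ⟩ → ∃[ a ] (∀ i → w i ≈ a * v i)
  ∈⟨⟩⇒multiple (a , w≈av) = a zero , λ i → trans (w≈av i) (+-identityʳ _)

  𝟎≼ : ∀ A → 𝟎 ≼ A
  𝟎≼ (m , g) w (_ , w≈0) = (λ _ → 0#) , λ i → begin
    w i                      ≈⟨ w≈0 i ⟩
    0#                       ≈⟨ zeroˡ _ ⟨
    0# * sum (λ j → g j i)   ≈⟨ *-distribˡ-sum 0# (λ j → g j i) ⟩
    sum (λ j → 0# * g j i)   ∎

  tail≼ : ∀ {m} (g : Vector V (suc m)) → (m , tail g) ≼ (suc m , g)
  tail≼ g w (a , w≈ag) =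
    (0# ∷ a) , λ i → trans (w≈ag i) (sym (trans (+-congʳ (zeroˡ (g zero i))) (+-identityˡ _)))

  ⟨⟩≼ : ∀ {v} A → v ∈ A → ⟨ v ⟩ ≼ A
  ⟨⟩≼ A v∈A w w∈⟨v⟩ with ∈⟨⟩⇒multiple w∈⟨v⟩
  ... | a , w≈av = ∈-resp-≈ᵥ A w≈av (∈-scale A a v∈A)

  ⟨0⟩≼𝟎 : ∀ {v} → v ≈ᵥ 0ᵥ → ⟨ v ⟩ ≼ 𝟎
  ⟨0⟩≼𝟎 v≈0 w w∈⟨v⟩ with ∈⟨⟩⇒multiple w∈⟨v⟩
  ... | a , w≈av = (λ ()) , λ i → trans (w≈av i) (trans (*-congˡ (v≈0 i)) (zeroʳ a))

  ⟨⟩-dim1 : ∀ {v} → ¬ (v ≈ᵥ 0ᵥ) → HasDim ⟨ v ⟩ 1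
  ⟨⟩-dim1 {v} v≉0 = (λ _ → v) , independent , (λ _ w∈ → w∈) , (λ _ w∈ → w∈)
    where
    independent : LinIndep {1} (λ _ → v)
    independent a av≈0 zero with a zero ≈? 0#
    ... | yes a≈0 = a≈0
    ... | no a≉0 with inverse (a zero) a≉0
    ... | b , ab≈1 = ⊥-elim (v≉0 λ i →
            trans (scale-inverse ab≈1 (sym (trans (sym (+-identityʳ _)) (av≈0 i)))) (zeroʳ b))

  ⟨⟩∩-absorb : ∀ {v} A → v ∈ A → IsMeet ⟨ v ⟩ A ⟨ v ⟩
  ⟨⟩∩-absorb A v∈A w = (λ w∈⟨v⟩ → w∈⟨v⟩ , ⟨⟩≼ A v∈A w w∈⟨v⟩) , proj₁

  ⟨⟩∩-trivial : ∀ {v} A → ¬ v ∈ A → IsMeet ⟨ v ⟩ A 𝟎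
  ⟨⟩∩-trivial {v} A v∉A w = (λ w∈𝟎 → 𝟎≼ ⟨ v ⟩ w w∈𝟎 , 𝟎≼ A w w∈𝟎) , in-both
    where
    in-both : w ∈ ⟨ v ⟩ × w ∈ A → w ∈ 𝟎
    in-both (w∈⟨v⟩ , w∈A) with ∈⟨⟩⇒multiple w∈⟨v⟩
    ... | a , w≈av with a ≈? 0#
    ...   | yes a≈0 = (λ ()) , λ i → trans (w≈av i) (trans (*-congʳ a≈0) (zeroˡ (v i)))
    ...   | no a≉0 with inverse a a≉0
    ...     | b , ab≈1 =
                ⊥-elim (v∉A (∈-resp-≈ᵥ A (λ i → scale-inverse ab≈1 (w≈av i)) (∈-scale A b w∈A)))

  -- Whether v ∈ A is not decided; the meet is only used to bound a rank in ℕ, so ¬¬ suffices.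
  ⟨⟩∩-exists : ∀ v A → ¬ ¬ (∃[ C ] IsMeet ⟨ v ⟩ A C)
  ⟨⟩∩-exists v A ∄C = ∄C (𝟎 , ⟨⟩∩-trivial A λ v∈A → ∄C (⟨ v ⟩ , ⟨⟩∩-absorb A v∈A))

module Rank {c ℓ : Level} {q : ℕ} (F : FiniteField c ℓ q) (n : ℕ) where
  open Lattice F n
  open Span F n
  open FiniteField F using (0#)
  open import Data.Nat using (zero; suc; z≤n; _+_; _≤_; _≤?_; _≟_)
  import Data.Nat.Properties as ℕ
  open import Data.Fin using (zero)
  open import Data.Fin.Properties using (all?)
  open import Data.Vec.Functional using (Vector; tail)
  open import Data.Sum using (_⊎_)
  open import Data.Empty using (⊥-elim)
  open import Relation.Binary.PropositionalEquality using (_≢_; sym; trans; subst)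
  open import Relation.Nullary using (yes; no)
  open import Relation.Nullary.Decidable using (decidable-stable)

  module _ (M : QMatroid) where

    ρ-dim0 : ∀ (g : Vector V 0) → ρ M (0 , g) ≡ 0
    ρ-dim0 g = ℕ.n≤0⇒n≡0 (ρ-bounded M (0 , g) 0 (g , (λ _ _ ()) , (λ _ w∈ → w∈) , (λ _ w∈ → w∈)))

    ρ⟨⟩≤1 : ∀ v → ρ M ⟨ v ⟩ ≤ 1
    ρ⟨⟩≤1 v with all? (λ i → v i ≈? 0#)
    ... | yes v≈0 = ℕ.≤-trans (ρ-monotone M ⟨ v ⟩ 𝟎 (⟨0⟩≼𝟎 v≈0))
                              (subst (_≤ 1) (sym (ρ-dim0 _)) z≤n)
    ... | no v≉0  = ρ-bounded M ⟨ v ⟩ 1 (⟨⟩-dim1 v≉0)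

    ρ-⊕≤+ : ∀ {A B C} → IsMeet A B C → ρ M (A ⊕ B) ≤ ρ M A + ρ M B
    ρ-⊕≤+ {A} {B} {C} meet = ℕ.≤-trans (ℕ.m≤m+n _ (ρ M C)) (ρ-submod M A B C meet)

    ρ-⊕⟨⟩≤suc : ∀ v A → ρ M (⟨ v ⟩ ⊕ A) ≤ suc (ρ M A)
    ρ-⊕⟨⟩≤suc v A = decidable-stable (_ ≤? _) λ ≰ →
      ⟨⟩∩-exists v A λ (C , meet) → ≰ (ℕ.≤-trans (ρ-⊕≤+ meet) (ℕ.+-monoˡ-≤ (ρ M A) (ρ⟨⟩≤1 v)))

    -- (suc m , g) and ⟨ g zero ⟩ ⊕ (m , tail g) have definitionally the same members.
    rank-step : ∀ {m} (g : Vector V (suc m)) →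
                ρ M (m , tail g) ≤ ρ M (suc m , g) × ρ M (suc m , g) ≤ suc (ρ M (m , tail g))
    rank-step {m} g = ρ-monotone M _ _ (tail≼ g)
                    , ℕ.≤-trans (ℕ.≤-reflexive (ρ-resp M _ _ ((λ _ w∈ → w∈) , (λ _ w∈ → w∈))))
                                (ρ-⊕⟨⟩≤suc (g zero) (m , tail g))

  module _ (M₁ M₂ : QMatroid) where

    RanksDifferByOne : Subspace → Set
    RanksDifferByOne Y = ρ M₁ Y ≡ suc (ρ M₂ Y) ⊎ ρ M₂ Y ≡ suc (ρ M₁ Y)

    ≢⇒differByOne : ∀ {m} (g : Vector V m) → ρ M₁ (m , g) ≢ ρ M₂ (m , g) → ∃[ Y ] RanksDifferByOne Y
    ≢⇒differByOne {zero} g ρ₁≢ρ₂ = ⊥-elim (ρ₁≢ρ₂ (trans (ρ-dim0 M₁ g) (sym (ρ-dim0 M₂ g))))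
    ≢⇒differByOne {suc m} g ρ₁≢ρ₂ with ρ M₁ (m , tail g) ≟ ρ M₂ (m , tail g)
    ... | no ρ₁≢ρ₂-on-tail = ≢⇒differByOne (tail g) ρ₁≢ρ₂-on-tail
    ... | yes ρ₁≡ρ₂-on-tail with rank-step M₁ g | rank-step M₂ g
    ...   | lo₁ , hi₁ | lo₂ , hi₂ = (suc m , g) , ≢-within-step⇒adjacent lo₁ hi₁
            (subst (_≤ _) (sym ρ₁≡ρ₂-on-tail) lo₂)
            (subst (λ t → _ ≤ suc t) (sym ρ₁≡ρ₂-on-tail) hi₂)
            ρ₁≢ρ₂

    ¬≗⇒¬¬differByOne : ¬ (∀ X → ρ M₁ X ≡ ρ M₂ X) → ¬ ¬ (∃[ Y ] RanksDifferByOne Y)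
    ¬≗⇒¬¬differByOne M₁≉M₂ ∄Y =
      M₁≉M₂ λ (_ , g) → decidable-stable (_ ≟ _) λ ρ₁≢ρ₂ → ∄Y (≢⇒differByOne g ρ₁≢ρ₂)

module CombinedRank {c ℓ : Level} {q : ℕ} (F : FiniteField c ℓ q) (n : ℕ)
                    (M₁ M₂ : Lattice.QMatroid F n) (p : ℚ)
  where
  open Lattice F n
  open Rank F n
  open import Data.Nat using (zero; suc; _∸_) renaming (_+_ to _+ₙ_; _*_ to _*ₙ_)
  open import Data.Integer using (∣_∣)
  open import Data.Nat.Divisibility using (_∣_; _∣?_; ∣⇒≤)
  open import Data.Rational using (_+_; _*_; _-_; _≤_; ↥_)
  import Data.Rational.Properties as ℚ
  open import Data.Sum using (inj₁; inj₂)
  open import Data.Empty using (⊥-elim)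
  open import Relation.Binary.PropositionalEquality using (refl; sym; cong; module ≡-Reasoning)
  open import Relation.Nullary.Decidable using (decidable-stable)
  open ≡-Reasoning

  r : Subspace → ℚ
  r = combRank p M₁ M₂

  combRank-denominator : 0ℚ ≤ p → p ≤ 1ℚ → IsDenominator r (ℕ→ℚ (↧ₙ p))
  combRank-denominator 0≤p p≤1 = fromℕ-pos (↧ₙ p) , λ X →
    a *ₙ ρ M₁ X +ₙ (↧ₙ p ∸ a) *ₙ ρ M₂ X , ↧ₙ*combination≡ p (↥-nonNeg 0≤p) p≤1 (ρ M₁ X) (ρ M₂ X)
    where a = ∣ ↥ p ∣

  integral-at-differByOne⇒↧ₙ∣ : ∀ {a} → ↥ p ≡ + a → ∀ {Y K} → RanksDifferByOne M₁ M₂ Y →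
                                ∃[ k ] (ℕ→ℚ K * r Y ≡ ℕ→ℚ k) → ↧ₙ p ∣ K
  integral-at-differByOne⇒↧ₙ∣ ↥p≡a {Y} {K} (inj₁ ρ₁≡1+ρ₂) (k , Kr≡k) =
    ↧ₙ∣-if-integral p ↥p≡a K (K *ₙ s) k (begin
      ℕ→ℚ K * p + ℕ→ℚ (K *ₙ s)                      ≡⟨ cong (_+_ (ℕ→ℚ K * p)) (fromℕ-* K s) ⟩
      ℕ→ℚ K * p + ℕ→ℚ K * ℕ→ℚ s                     ≡⟨ ℚ.*-distribˡ-+ (ℕ→ℚ K) p (ℕ→ℚ s) ⟨
      ℕ→ℚ K * (p + ℕ→ℚ s)                           ≡⟨ cong (ℕ→ℚ K *_) (p*[1+s]+[1-p]*s≡p+s p s) ⟨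
      ℕ→ℚ K * (p * ℕ→ℚ (suc s) + (1ℚ - p) * ℕ→ℚ s)  ≡⟨ cong (λ t → ℕ→ℚ K * (p * ℕ→ℚ t + (1ℚ - p) * ℕ→ℚ s))
                                                         ρ₁≡1+ρ₂ ⟨
      ℕ→ℚ K * r Y                                   ≡⟨ Kr≡k ⟩
      ℕ→ℚ k                                         ∎)
    where s = ρ M₂ Y
  integral-at-differByOne⇒↧ₙ∣ ↥p≡a {Y} {K} (inj₂ ρ₂≡1+ρ₁) (k , Kr≡k) =
    ↧ₙ∣-if-integral p ↥p≡a K k (K *ₙ suc s) (begin
      ℕ→ℚ K * p + ℕ→ℚ k                                    ≡⟨ cong (_+_ (ℕ→ℚ K * p)) Kr≡k ⟨
      ℕ→ℚ K * p + ℕ→ℚ K * r Y                              ≡⟨ ℚ.*-distribˡ-+ (ℕ→ℚ K) p (r Y) ⟨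
      ℕ→ℚ K * (p + r Y)                                    ≡⟨ cong (λ t → ℕ→ℚ K *
                                                                (p + (p * ℕ→ℚ s + (1ℚ - p) * ℕ→ℚ t))) ρ₂≡1+ρ₁ ⟩
      ℕ→ℚ K * (p + (p * ℕ→ℚ s + (1ℚ - p) * ℕ→ℚ (suc s)))   ≡⟨ cong (ℕ→ℚ K *_) (p+[p*s+[1-p]*[1+s]]≡1+s p s) ⟩
      ℕ→ℚ K * ℕ→ℚ (suc s)                                  ≡⟨ fromℕ-* K (suc s) ⟨
      ℕ→ℚ (K *ₙ suc s)                                     ∎)
    where s = ρ M₁ Y

  ↧ₙ∣-if-integral-multiple : 0ℚ ≤ p → ¬ (∀ X → ρ M₁ X ≡ ρ M₂ X) →
                             ∀ K → (∀ Y → ∃[ k ] (ℕ→ℚ K * r Y ≡ ℕ→ℚ k)) → ↧ₙ p ∣ K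
  ↧ₙ∣-if-integral-multiple 0≤p M₁≉M₂ K integral = decidable-stable (↧ₙ p ∣? K) λ ↧ₙp∤K →
    ¬≗⇒¬¬differByOne M₁ M₂ M₁≉M₂ λ (Y , differ) →
      ↧ₙp∤K (integral-at-differByOne⇒↧ₙ∣ (↥-nonNeg 0≤p) differ (integral Y))

  denominator-at-rank-one : ∀ {x ν} → IsDenominator r ν → r x ≡ 1ℚ → ∃[ K ] (ν ≡ ℕ→ℚ (suc K))
  denominator-at-rank-one {x} {ν} (0<ν , integral) r[x]≡1 with integral x
  ... | K , νr[x]≡K = positive K (begin
    ν        ≡⟨ ℚ.*-identityʳ ν ⟨
    ν * 1ℚ   ≡⟨ cong (ν *_) r[x]≡1 ⟨
    ν * r x  ≡⟨ νr[x]≡K ⟩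
    ℕ→ℚ K    ∎)
    where
    positive : ∀ K → ν ≡ ℕ→ℚ K → ∃[ K′ ] (ν ≡ ℕ→ℚ (suc K′))
    positive zero ν≡0 = ⊥-elim (ℚ.<-irrefl (sym ν≡0) 0<ν)
    positive (suc K) ν≡K = K , ν≡K

  combRank-principal : 0ℚ ≤ p → p ≤ 1ℚ → ¬ (∀ X → ρ M₁ X ≡ ρ M₂ X) →
                       ∀ x → r x ≡ 1ℚ → IsPrincipalDenominator r (ℕ→ℚ (↧ₙ p))
  combRank-principal 0≤p p≤1 M₁≉M₂ x r[x]≡1 = combRank-denominator 0≤p p≤1 , minimal
    where
    minimal : ∀ ν → IsDenominator r ν → ℕ→ℚ (↧ₙ p) ≤ ν
    minimal ν ν-denominator@(_ , integral) with denominator-at-rank-one ν-denominator r[x]≡1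
    ... | K , refl = fromℕ-mono-≤ (∣⇒≤ (↧ₙ∣-if-integral-multiple 0≤p M₁≉M₂ (suc K) integral))

theorem4p12 : ∀ {c ℓ : Level} (q : ℕ) → IsPrimePower q → (F : FiniteField c ℓ q) (n : ℕ)
    → let open Lattice F n in
      (M₁ M₂ : QMatroid)
    → ¬ (∀ X → ρ M₁ X ≡ ρ M₂ X)
    → (λ′ : ℚ) → 0ℚ < λ′ → λ′ < 1ℚ
    → (∃[ x ] (HasDim x 1 × ∃[ ν ] (IsDenominator (combRank λ′ M₁ M₂) ν
                                    × IsStrongIndependent (combRank λ′ M₁ M₂) ν x)))
    → IsPrincipalDenominator (combRank λ′ M₁ M₂) (+ (↧ₙ λ′) / 1)
theorem4p12 _ _ F n M₁ M₂ M₁≉M₂ λ′ 0<λ′ λ′<1 (x , x-dim1 , _ , _ , _ , r≡dim) =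
  combRank-principal (ℚ.<⇒≤ 0<λ′) (ℚ.<⇒≤ λ′<1) M₁≉M₂ x (r≡dim 1 x-dim1)
  where
  open CombinedRank F n M₁ M₂ λ′
  import Data.Rational.Properties as ℚ
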